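{- Let $G=(V,E)$ be a simple connected undirected graph with $n=|V|\ge4$ vertices and $m=|E|$ edges, with degree sequence $d_1\ge d_2\ge\dots\ge d_n$ of the form $(d_1,\dots,d_{n-h},1,\dots,1)$, i.e. with exactly $h\ge1$ pendant vertices, where $n-h\ge2$, and assume $1+d_1\le d_{n-h}+d_{n-h-1}$. Set $a=\sum_{i=1}^n d_i^2$, $m_1=d_{n-h}+d_{n-h-1}$, $m_2=1+d_{n-h}$, $M_1=d_1+d_2$, $M_2=1+d_1$, and $$S=\Big\{\mathbf x\in\mathbb R^m:\ x_1\ge\dots\ge x_m\ge0,\ \sum_{i=1}^m x_i=a,\ M_1\ge x_1\ge\dots\ge x_{m-h}\ge m_1,\ M_2\ge x_{m-h+1}\ge\dots\ge x_m\ge m_2\Big\}.$$ Let $\mathbf x^*(S)$ and $\mathbf x_*(S)$ be the maximal and minimal elements of $S$ with respect to the majorization order. Then the second Zagreb index $S(G)=\sum_{(v_i,v_j)\in E}d_id_j$ satisfies $$\frac{\|\mathbf x_*(S)\|_2^2-\sum_{i=1}^n d_i^3}{2}\ \le\ S(G)\ \le\ \frac{\|\mathbf x^*(S)\|_2^2-\sum_{i=1}^n d_i^3}{2}.$$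
   Context: $d_i$ is the degree of vertex $v_i$; a pendant vertex is a vertex of degree $1$. For vectors $\mathbf x,\mathbf y\in\mathbb R^m$ with components arranged in nonincreasing order, $\mathbf x\trianglelefteq\mathbf y$ (majorization) means $\sum_{i=1}^j x_i\le\sum_{i=1}^j y_i$ for $j=1,\dots,m-1$ and $\sum_{i=1}^m x_i=\sum_{i=1}^m y_i$. The maximal (resp. minimal) element of $S$ is the element $\mathbf x^*(S)\in S$ (resp. $\mathbf x_*(S)\in S$) with $\mathbf x\trianglelefteq\mathbf x^*(S)$ (resp. $\mathbf x_*(S)\trianglelefteq\mathbf x$) for all $\mathbf x\in S$. $\|\cdot\|_2$ is the Euclidean norm.
   Formalization: The set S, and with it its maximal and minimal elements $\mathbf x^*(S)$ and $\mathbf x_*(S)$, are taken in ℚ^m instead of ℝ^m. -}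

module Defs where

open import Data.Nat as ℕ using (ℕ; zero; suc; _<_; _<?_)
open import Data.Fin using (Fin; toℕ; fromℕ<)
import Data.Fin as F
open import Data.Bool using (Bool; true; false; if_then_else_)
open import Data.Rational as ℚ using (ℚ; 0ℚ)
open import Relation.Binary.PropositionalEquality using (_≡_)
open import Relation.Nullary using (yes; no; ¬_)
open import Data.Product using (_×_)

Σℕ : (n : ℕ) → (Fin n → ℕ) → ℕ
Σℕ zero    f = 0
Σℕ (suc n) f = f F.zero ℕ.+ Σℕ n (λ i → f (F.suc i))

Σℚ : (n : ℕ) → (Fin n → ℚ) → ℚ
Σℚ zero    f = 0ℚ
Σℚ (suc n) f = f F.zero ℚ.+ Σℚ n (λ i → f (F.suc i))

-- A simple undirected graph on vertex set Fin n (vertex v_{k+1} is Fin index k)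
record Graph (n : ℕ) : Set where
  field
    adj   : Fin n → Fin n → Bool
    sym   : ∀ i j → adj i j ≡ adj j i
    irref : ∀ i → adj i i ≡ false
open Graph public

b2n : Bool → ℕ
b2n true  = 1
b2n false = 0

deg : ∀ {n} → Graph n → Fin n → ℕ
deg G i = Σℕ _ (λ j → b2n (adj G i j))

-- degree of the vertex with 0-based index k (0 if out of range)
degAt : ∀ {n} → Graph n → ℕ → ℕ
degAt {n} G k with k <? n
... | yes k<n = deg G (fromℕ< k<n)
... | no  _   = 0

edgeCount : ∀ {n} → Graph n → ℕ
edgeCount {n} G = Σℕ n (λ i → Σℕ n (λ j →
  if toℕ i ℕ.<ᵇ toℕ j then b2n (adj G i j) else 0))

zagreb2 : ∀ {n} → Graph n → ℕ
zagreb2 {n} G = Σℕ n (λ i → Σℕ n (λ j →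
  if toℕ i ℕ.<ᵇ toℕ j then b2n (adj G i j) ℕ.* (deg G i ℕ.* deg G j) else 0))

data Reach {n} (G : Graph n) (i : Fin n) : Fin n → Set where
  here : Reach G i i
  step : ∀ {j k} → Reach G i j → adj G j k ≡ true → Reach G i k

Connected : ∀ {n} → Graph n → Set
Connected G = ∀ i j → Reach G i j

DegNonincreasing : ∀ {n} → Graph n → Set
DegNonincreasing G = ∀ i j → toℕ i ℕ.≤ toℕ j → deg G j ℕ.≤ deg G i

-- vectors in ℚ^m (components x_1..x_m are indices 0..m-1)
Vecℚ : ℕ → Set
Vecℚ m = Fin m → ℚ

Nonincreasing : ∀ {m} → Vecℚ m → Set
Nonincreasing x = ∀ i j → toℕ i ℕ.≤ toℕ j → x j ℚ.≤ x i

partialSum : ∀ {m} → Vecℚ m → ℕ → ℚ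
partialSum {m} x k = Σℚ m (λ i → if toℕ i ℕ.<ᵇ k then x i else 0ℚ)

-- majorization x ⊴ y (for vectors with nonincreasing components)
_⊴_ : ∀ {m} → Vecℚ m → Vecℚ m → Set
_⊴_ {m} x y = (∀ j → 1 ℕ.≤ j → j < m → partialSum x j ℚ.≤ partialSum y j)
            × Σℚ m x ≡ Σℚ m y

normSq : ∀ {m} → Vecℚ m → ℚ
normSq {m} x = Σℚ m (λ i → x i ℚ.* x i)

InS : (m h : ℕ) (a m₁ m₂ M₁ M₂ : ℚ) → Vecℚ m → Set
InS m h a m₁ m₂ M₁ M₂ x =
  Nonincreasing x
  × (∀ i → 0ℚ ℚ.≤ x i)
  × Σℚ m x ≡ a
  × (∀ i → toℕ i < m ℕ.∸ h → (x i ℚ.≤ M₁) × (m₁ ℚ.≤ x i))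
  × (∀ i → m ℕ.∸ h ℕ.≤ toℕ i → (x i ℚ.≤ M₂) × (m₂ ℚ.≤ x i))

IsMaximal IsMinimal : ∀ {m} → (Vecℚ m → Set) → Vecℚ m → Set
IsMaximal S x = S x × (∀ y → S y → y ⊴ x)
IsMinimal S x = S x × (∀ y → S y → x ⊴ y)

open import Data.Integer using (+_)

toℚ : ℕ → ℚ
toℚ k = (+ k) ℚ./ 1

module Submission where

-- For each edge {i, j} of G take the number d_i + d_j.  Summing these gives
-- Σ_{ij∈E} (d_i + d_j) = Σ_i d_i² = a, and summing their squares gives
-- Σ_{ij∈E} (d_i + d_j)² = Σ_i d_i³ + 2 S(G).  Sorting the edges that avoid
-- the pendant vertices first and the h pendant edges last, each block in
-- decreasing order, yields a vector y ∈ S (the hypothesis 1 + d₁ ≤ m₁ is what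
-- puts the pendant block behind the other one).  Extremality then gives
-- x_*(S) ⊴ y ⊴ x^*(S), and since the sum of squares is Schur-convex,
-- ‖x_*(S)‖² ≤ Σ d_i³ + 2 S(G) ≤ ‖x^*(S)‖², which rearranges to the theorem.

open import Data.Nat using (ℕ)
open import Defs hiding (sym)

module RationalFacts where

  import Data.Nat as ℕ
  open import Data.Integer as ℤ using (+_)
  import Data.Integer.Properties as ℤP
  import Data.Integer.Solver as ℤSolver
  open import Data.Rational using (mkℚ; toℚᵘ; 0ℚ; ½; -_; _+_; _-_; _*_; _≤_; *≤*; nonNegative)
  open import Data.Unit using (tt)
  open import Data.Rational.Properties
  open import Data.Rational.Solver using (module +-*-Solver)
  import Data.Rational.Unnormalised as ℚᵘ
  import Data.Rational.Unnormalised.Properties as ℚᵘP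
  import Data.Nat.Coprimality as Coprimality
  open import Data.Sum using (inj₁; inj₂)
  open import Relation.Binary.PropositionalEquality

  -- toℚ k is the normalised fraction k/1; exposing that literal form makes
  -- the arithmetic of toℚ a matter of integer arithmetic.
  toℚ≡mkℚ : ∀ k → toℚ k ≡ mkℚ (+ k) 0 (Coprimality.sym (Coprimality.1-coprimeTo k))
  toℚ≡mkℚ k = normalize-coprime (Coprimality.sym (Coprimality.1-coprimeTo k))

  toℚ-+ : ∀ a b → toℚ (a ℕ.+ b) ≡ toℚ a + toℚ b
  toℚ-+ a b = toℚᵘ-injective (ℚᵘP.≃-trans unnormalised (ℚᵘP.≃-sym (toℚᵘ-homo-+ (toℚ a) (toℚ b))))
    where
    open ℤSolver.+-*-Solver
    unnormalised : toℚᵘ (toℚ (a ℕ.+ b)) ℚᵘ.≃ toℚᵘ (toℚ a) ℚᵘ.+ toℚᵘ (toℚ b)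
    unnormalised rewrite toℚ≡mkℚ (a ℕ.+ b) | toℚ≡mkℚ a | toℚ≡mkℚ b =
      ℚᵘ.*≡* (solve 2 (λ x y → (x :+ y) :* (con (+ 1) :* con (+ 1))
                              := (x :* con (+ 1) :+ y :* con (+ 1)) :* con (+ 1)) refl (+ a) (+ b))

  toℚ-* : ∀ a b → toℚ (a ℕ.* b) ≡ toℚ a * toℚ b
  toℚ-* a b = toℚᵘ-injective (ℚᵘP.≃-trans unnormalised (ℚᵘP.≃-sym (toℚᵘ-homo-* (toℚ a) (toℚ b))))
    where
    unnormalised : toℚᵘ (toℚ (a ℕ.* b)) ℚᵘ.≃ toℚᵘ (toℚ a) ℚᵘ.* toℚᵘ (toℚ b)
    unnormalised rewrite toℚ≡mkℚ (a ℕ.* b) | toℚ≡mkℚ a | toℚ≡mkℚ b | sym (ℤP.pos-* a b) = ℚᵘ.*≡* refl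

  toℚ-mono : ∀ {a b} → a ℕ.≤ b → toℚ a ≤ toℚ b
  toℚ-mono {a} {b} a≤b rewrite toℚ≡mkℚ a | toℚ≡mkℚ b = *≤* (ℤP.*-monoʳ-≤-nonNeg (+ 1) (ℤ.+≤+ a≤b))

  p≤p+q : ∀ {p q} → 0ℚ ≤ q → p ≤ p + q
  p≤p+q {p} 0≤q = subst (_≤ p + _) (+-identityʳ p) (+-monoʳ-≤ p 0≤q)

  p≤q⇒0≤q-p : ∀ {p q} → p ≤ q → 0ℚ ≤ q - p
  p≤q⇒0≤q-p {p} {q} p≤q = subst (_≤ q - p) (+-inverseʳ p) (+-monoˡ-≤ (- p) p≤q)

  0≤q-p⇒p≤q : ∀ {p q} → 0ℚ ≤ q - p → p ≤ q
  0≤q-p⇒p≤q {p} {q} 0≤q-p = subst₂ _≤_ (+-identityʳ p) p+[q-p]≡q (+-monoʳ-≤ p 0≤q-p)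
    where
    open +-*-Solver
    p+[q-p]≡q : p + (q - p) ≡ q
    p+[q-p]≡q = solve 2 (λ p q → p :+ (q :- p) := q) refl p q

  0≤p*q : ∀ {p q} → 0ℚ ≤ p → 0ℚ ≤ q → 0ℚ ≤ p * q
  0≤p*q {p} 0≤p 0≤q = subst (_≤ p * _) (*-zeroʳ p) (*-monoˡ-≤-nonNeg p {{nonNegative 0≤p}} 0≤q)

  0≤p*p : ∀ p → 0ℚ ≤ p * p
  0≤p*p p with ≤-total 0ℚ p
  ... | inj₁ 0≤p = 0≤p*q 0≤p 0≤p
  ... | inj₂ p≤0 = subst (0ℚ ≤_) [-p][-p]≡pp (0≤p*q (neg-antimono-≤ p≤0) (neg-antimono-≤ p≤0))
    where
    open +-*-Solver
    [-p][-p]≡pp : (- p) * (- p) ≡ p * p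
    [-p][-p]≡pp = solve 1 (λ p → (:- p) :* (:- p) := p :* p) refl p

  0≤½ : 0ℚ ≤ ½
  0≤½ = ≤ᵇ⇒≤ tt

  -- Bounds on p against c + 2z become bounds of (p - c)/2 against z; this
  -- turns bounds on ‖x‖² versus Σ d³ + 2 S(G) into bounds on S(G).
  halve-≤ : ∀ {p c z} → p ≤ c + (z + z) → (p - c) * ½ ≤ z
  halve-≤ {p} {c} {z} p≤ = 0≤q-p⇒p≤q (subst (0ℚ ≤_) eq (0≤p*q (p≤q⇒0≤q-p p≤) 0≤½))
    where
    open +-*-Solver
    eq : (c + (z + z) - p) * ½ ≡ z - (p - c) * ½
    eq = solve 3 (λ c z p → (c :+ (z :+ z) :- p) :* con ½ := z :- (p :- c) :* con ½) refl c z p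

  ≤-halve : ∀ {p c z} → c + (z + z) ≤ p → z ≤ (p - c) * ½
  ≤-halve {p} {c} {z} ≤p = 0≤q-p⇒p≤q (subst (0ℚ ≤_) eq (0≤p*q (p≤q⇒0≤q-p ≤p) 0≤½))
    where
    open +-*-Solver
    eq : (p - (c + (z + z))) * ½ ≡ (p - c) * ½ - z
    eq = solve 3 (λ c z p → (p :- (c :+ (z :+ z))) :* con ½ := (p :- c) :* con ½ :- z) refl c z p

module Majorization where

  open import Data.Nat as ℕ using (zero; suc; z≤n; s≤s)
  open import Data.Fin using (zero; suc)
  open import Data.Rational using (ℚ; 0ℚ; -_; _+_; _-_; _*_; _≤_; nonNegative)
  open import Data.Rational.Properties
  open import Data.Rational.Solver using (module +-*-Solver)
  open import Data.Product using (_,_)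
  open import Relation.Binary.PropositionalEquality
  open RationalFacts
  open +-*-Solver

  partialSum-zero : ∀ {m} (x : Vecℚ m) → partialSum x 0 ≡ 0ℚ
  partialSum-zero {zero} x = refl
  partialSum-zero {suc m} x = trans (+-identityˡ _) (partialSum-zero (λ i → x (suc i)))

  -- Moving the leading entries x₀, y₀ of x₀ + P ≤ s + (y₀ + Q) (or of the
  -- corresponding equality) into the shift s' = s + y₀ - x₀; this is how the
  -- slack propagates down the vectors in the induction below.
  cancel-head : ∀ x₀ P → - x₀ + (x₀ + P) ≡ P
  cancel-head = solve 2 (λ x₀ P → :- x₀ :+ (x₀ :+ P) := P) refl

  rebase : ∀ x₀ y₀ s Q → - x₀ + (s + (y₀ + Q)) ≡ (s + y₀ - x₀) + Q
  rebase = solve 4 (λ x₀ y₀ s Q → :- x₀ :+ (s :+ (y₀ :+ Q)) := (s :+ y₀ :- x₀) :+ Q) refl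

  shift-≤ : ∀ {x₀ y₀ s P Q} → x₀ + P ≤ s + (y₀ + Q) → P ≤ (s + y₀ - x₀) + Q
  shift-≤ {x₀} {y₀} {s} {P} {Q} le = subst₂ _≤_ (cancel-head x₀ P) (rebase x₀ y₀ s Q) (+-monoʳ-≤ (- x₀) le)

  shift-≡ : ∀ {x₀ y₀ s P Q} → x₀ + P ≡ s + (y₀ + Q) → P ≡ (s + y₀ - x₀) + Q
  shift-≡ {x₀} {y₀} {s} {P} {Q} eq =
    trans (sym (cancel-head x₀ P)) (trans (cong (- x₀ +_) eq) (rebase x₀ y₀ s Q))

  -- Schur-convexity of the sum of squares, in the form with a slack s that
  -- makes the induction on the length go through: if the partial sums of a
  -- nonincreasing x are bounded by s plus those of y, with equality for the
  -- full sums, then ‖x‖² ≤ 2s·x₀ + ‖y‖².  (This is Abel summation unrolled.)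
  normSq-shifted : ∀ m (x y : Vecℚ (suc m)) (s : ℚ) → Nonincreasing x
    → (∀ j → 1 ℕ.≤ j → j ℕ.< suc m → partialSum x j ≤ s + partialSum y j)
    → Σℚ (suc m) x ≡ s + Σℚ (suc m) y
    → normSq x ≤ (s + s) * x zero + normSq y
  -- Base: x₀ = s + y₀, and (s + y₀)² + s² = 2s(s + y₀) + y₀².
  normSq-shifted zero x y s _ _ total = begin
      x₀ * x₀ + 0ℚ
        ≡⟨ cong (λ t → t * t + 0ℚ) x₀≡s+y₀ ⟩
      (s + y₀) * (s + y₀) + 0ℚ
        ≤⟨ p≤p+q (0≤p*p s) ⟩
      (s + y₀) * (s + y₀) + 0ℚ + s * s
        ≡⟨ solve 2 (λ s y₀ → (s :+ y₀) :* (s :+ y₀) :+ con 0ℚ :+ s :* s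
                              := (s :+ s) :* (s :+ y₀) :+ (y₀ :* y₀ :+ con 0ℚ)) refl s y₀ ⟩
      (s + s) * (s + y₀) + (y₀ * y₀ + 0ℚ)
        ≡⟨ cong (λ t → (s + s) * t + (y₀ * y₀ + 0ℚ)) (sym x₀≡s+y₀) ⟩
      (s + s) * x₀ + (y₀ * y₀ + 0ℚ)
        ∎
    where
    open ≤-Reasoning
    x₀ = x zero
    y₀ = y zero
    x₀≡s+y₀ : x₀ ≡ s + y₀
    x₀≡s+y₀ = trans (sym (+-identityʳ x₀)) (trans total (cong (s +_) (+-identityʳ y₀)))
  -- Step: the tail x′ satisfies the hypotheses with slack s′ = s + y₀ - x₀ ≥ 0,
  -- so ‖x′‖² ≤ 2s′x₁ + ‖y′‖² ≤ 2s′x₀ + ‖y′‖²; adding x₀² and (y₀ - x₀)² ≥ 0,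
  -- the identity x₀² + 2s′x₀ + (y₀ - x₀)² = 2s·x₀ + y₀² closes the step.
  normSq-shifted (suc m) x y s x↘ partial total = begin
      x₀ * x₀ + normSq x′
        ≤⟨ +-monoʳ-≤ (x₀ * x₀) tail-bound ⟩
      x₀ * x₀ + ((s′ + s′) * x₁ + normSq y′)
        ≤⟨ +-monoʳ-≤ (x₀ * x₀) (+-monoˡ-≤ (normSq y′) x₁-step) ⟩
      x₀ * x₀ + ((s′ + s′) * x₀ + normSq y′)
        ≤⟨ p≤p+q (0≤p*p (y₀ - x₀)) ⟩
      x₀ * x₀ + ((s′ + s′) * x₀ + normSq y′) + (y₀ - x₀) * (y₀ - x₀)
        ≡⟨ solve 4 (λ s x₀ y₀ B →
                      x₀ :* x₀ :+ ((s :+ y₀ :- x₀ :+ (s :+ y₀ :- x₀)) :* x₀ :+ B) :+ (y₀ :- x₀) :* (y₀ :- x₀)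
                      := (s :+ s) :* x₀ :+ (y₀ :* y₀ :+ B)) refl s x₀ y₀ (normSq y′) ⟩
      (s + s) * x₀ + (y₀ * y₀ + normSq y′)
        ∎
    where
    open ≤-Reasoning
    x₀ = x zero
    x₁ = x (suc zero)
    y₀ = y zero
    x′ y′ : Vecℚ (suc m)
    x′ i = x (suc i)
    y′ i = y (suc i)
    s′ = s + y₀ - x₀
    drop-head : ∀ {P Q} → x₀ + P ≤ s + (y₀ + Q) → P ≤ s′ + Q
    drop-head = shift-≤ {x₀} {y₀} {s}
    0≤s′ : 0ℚ ≤ s′
    0≤s′ = subst (0ℚ ≤_) (+-identityʳ s′)
             (subst₂ (λ P Q → P ≤ s′ + Q) (partialSum-zero x′) (partialSum-zero y′)
               (drop-head (partial 1 (s≤s z≤n) (s≤s (s≤s z≤n)))))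
    tail-bound : normSq x′ ≤ (s′ + s′) * x₁ + normSq y′
    tail-bound = normSq-shifted m x′ y′ s′ (λ i j i≤j → x↘ (suc i) (suc j) (s≤s i≤j))
      (λ j _ j<m → drop-head (partial (suc j) (s≤s z≤n) (s≤s j<m)))
      (shift-≡ {x₀} {y₀} {s} total)
    x₁-step : (s′ + s′) * x₁ ≤ (s′ + s′) * x₀
    x₁-step = *-monoˡ-≤-nonNeg (s′ + s′) {{nonNegative (+-mono-≤ 0≤s′ 0≤s′)}} (x↘ zero (suc zero) z≤n)

  normSq-mono-⊴ : ∀ {m} (x y : Vecℚ m) → Nonincreasing x → x ⊴ y → normSq x ≤ normSq y
  normSq-mono-⊴ {zero} x y _ _ = ≤-refl
  normSq-mono-⊴ {suc m} x y x↘ (partial , total) =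
    subst (normSq x ≤_) no-slack
      (normSq-shifted m x y 0ℚ x↘
        (λ j 1≤j j<m → subst (partialSum x j ≤_) (sym (+-identityˡ _)) (partial j 1≤j j<m))
        (trans total (sym (+-identityˡ _))))
    where
    no-slack : (0ℚ + 0ℚ) * x zero + normSq y ≡ normSq y
    no-slack = solve 2 (λ a b → (con 0ℚ :+ con 0ℚ) :* a :+ b := b) refl (x zero) (normSq y)

module FiniteSums where

  open import Data.Nat using (zero; suc; _+_; _*_; _∸_; _≤_; _<ᵇ_)
  open import Data.Nat.Properties
  open import Algebra.Properties.CommutativeSemigroup +-commutativeSemigroup using (interchange)
  open import Data.Fin using (Fin; zero; suc; toℕ)
  open import Data.Bool using (if_then_else_)
  open import Relation.Binary.PropositionalEquality
  open import Relation.Nullary using (¬_)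
  open import Data.Empty using (⊥-elim)

  Σ-cong : ∀ n {f g : Fin n → ℕ} → (∀ i → f i ≡ g i) → Σℕ n f ≡ Σℕ n g
  Σ-cong zero    f≗g = refl
  Σ-cong (suc n) f≗g = cong₂ _+_ (f≗g zero) (Σ-cong n (λ i → f≗g (suc i)))

  Σ-zero : ∀ n → Σℕ n (λ _ → 0) ≡ 0
  Σ-zero zero    = refl
  Σ-zero (suc n) = Σ-zero n

  Σ-+ : ∀ n (f g : Fin n → ℕ) → Σℕ n (λ i → f i + g i) ≡ Σℕ n f + Σℕ n g
  Σ-+ zero    f g = refl
  Σ-+ (suc n) f g = trans (cong (f zero + g zero +_) (Σ-+ n _ _)) (interchange (f zero) (g zero) _ _)

  Σ-*ʳ : ∀ n (f : Fin n → ℕ) c → Σℕ n (λ i → f i * c) ≡ Σℕ n f * c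
  Σ-*ʳ zero    f c = refl
  Σ-*ʳ (suc n) f c = trans (cong (f zero * c +_) (Σ-*ʳ n _ c)) (sym (*-distribʳ-+ c (f zero) _))

  Σ²-+ : ∀ n m (f g : Fin n → Fin m → ℕ) → Σℕ n (λ i → Σℕ m (λ j → f i j + g i j))
         ≡ Σℕ n (λ i → Σℕ m (f i)) + Σℕ n (λ i → Σℕ m (g i))
  Σ²-+ n m f g = trans (Σ-cong n (λ i → Σ-+ m (f i) (g i))) (Σ-+ n _ _)

  Σ-swap : ∀ n m (f : Fin n → Fin m → ℕ) →
           Σℕ n (λ i → Σℕ m (λ j → f i j)) ≡ Σℕ m (λ j → Σℕ n (λ i → f i j))
  Σ-swap zero    m f = sym (Σ-zero m)
  Σ-swap (suc n) m f = trans (cong (Σℕ m (f zero) +_) (Σ-swap n m (λ i → f (suc i))))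
                             (sym (Σ-+ m (f zero) (λ j → Σℕ n (λ i → f (suc i) j))))

  Σ-term : ∀ n (f : Fin n → ℕ) a → f a ≤ Σℕ n f
  Σ-term (suc n) f zero    = m≤m+n _ _
  Σ-term (suc n) f (suc a) = ≤-trans (Σ-term n _ a) (m≤n+m _ _)

  Σ-two-terms : ∀ n (f : Fin n → ℕ) a b → ¬ a ≡ b → f a + f b ≤ Σℕ n f
  Σ-two-terms (suc n) f zero    zero    a≢b = ⊥-elim (a≢b refl)
  Σ-two-terms (suc n) f zero    (suc b) a≢b = +-monoʳ-≤ (f zero) (Σ-term n _ b)
  Σ-two-terms (suc n) f (suc a) zero    a≢b =
    subst (_≤ Σℕ (suc n) f) (+-comm (f zero) (f (suc a))) (+-monoʳ-≤ (f zero) (Σ-term n (λ i → f (suc i)) a))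
  Σ-two-terms (suc n) f (suc a) (suc b) a≢b =
    ≤-trans (Σ-two-terms n _ a b (λ a≡b → a≢b (cong suc a≡b))) (m≤n+m _ _)

  Σ-count-≥ : ∀ n k → Σℕ n (λ j → if toℕ j <ᵇ k then 0 else 1) ≡ n ∸ k
  Σ-count-≥ zero    zero    = refl
  Σ-count-≥ zero    (suc k) = refl
  Σ-count-≥ (suc n) zero    = cong suc (Σ-count-≥ n zero)
  Σ-count-≥ (suc n) (suc k) = Σ-count-≥ n k

module Lists where

  open import Data.Nat using (zero; suc; _+_; _∸_; _≤_; _<_; s≤s)
  open import Data.Nat.Properties using (≤-decTotalOrder; ≤-totalOrder; ≤-refl; ≤-trans; +-identityʳ)
  open import Data.Fin using (Fin; zero; suc)
  open import Data.Bool using (Bool; true; false; if_then_else_; T)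
  open import Data.List using (List; []; _∷_; _++_; length; map)
  open import Data.List.Properties using (map-++)
  open import Data.Nat.ListAction using (sum)
  open import Data.Nat.ListAction.Properties using (sum-++; sum-↭)
  open import Data.List.Relation.Unary.All as All using (All; []; _∷_)
  import Data.List.Relation.Unary.All.Properties as AllP
  open import Data.List.Relation.Unary.AllPairs using (AllPairs; []; _∷_)
  import Data.List.Relation.Unary.AllPairs.Properties as AllPairs
  open import Data.List.Relation.Binary.Permutation.Propositional using (_↭_; ↭-sym)
  open import Data.List.Relation.Binary.Permutation.Propositional.Properties
    using (map⁺; All-resp-↭; ↭-length)
  import Data.List.Sort
  import Data.List.Relation.Unary.Sorted.TotalOrder.Properties as Sorted
  import Relation.Binary.Construct.Flip.EqAndOrd as Flip
  open import Relation.Binary.PropositionalEquality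

  concatFin : ∀ {A : Set} n → (Fin n → List A) → List A
  concatFin zero    f = []
  concatFin (suc n) f = f zero ++ concatFin n (λ i → f (suc i))

  map-concatFin : ∀ {A B : Set} (φ : A → B) n (f : Fin n → List A) →
                  map φ (concatFin n f) ≡ concatFin n (λ i → map φ (f i))
  map-concatFin φ zero    f = refl
  map-concatFin φ (suc n) f = trans (map-++ φ (f zero) _) (cong (map φ (f zero) ++_) (map-concatFin φ n _))

  sum-concatFin : ∀ n (f : Fin n → List ℕ) → sum (concatFin n f) ≡ Σℕ n (λ i → sum (f i))
  sum-concatFin zero    f = refl
  sum-concatFin (suc n) f = trans (sum-++ (f zero) _) (cong (sum (f zero) +_) (sum-concatFin n _))

  All-concatFin : ∀ {A : Set} {P : A → Set} n (f : Fin n → List A) → (∀ i → All P (f i)) → All P (concatFin n f)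
  All-concatFin zero    f all = []
  All-concatFin (suc n) f all = AllP.++⁺ (all zero) (All-concatFin n _ (λ i → all (suc i)))

  singletonIf : ∀ {A : Set} → Bool → A → List A
  singletonIf b v = if b then v ∷ [] else []

  sum-singletonIf : ∀ b v → sum (singletonIf b v) ≡ (if b then v else 0)
  sum-singletonIf true  v = +-identityʳ v
  sum-singletonIf false v = refl

  map-singletonIf : ∀ {A B : Set} (φ : A → B) b v → map φ (singletonIf b v) ≡ singletonIf b (φ v)
  map-singletonIf φ true  v = refl
  map-singletonIf φ false v = refl

  All-singletonIf : ∀ {A : Set} {P : A → Set} b v → (T b → P v) → All P (singletonIf b v)
  All-singletonIf true  v p = p _ ∷ []
  All-singletonIf false v p = []

  length≡sum-of-ones : ∀ {A : Set} (xs : List A) → length xs ≡ sum (map (λ _ → 1) xs)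
  length≡sum-of-ones []       = refl
  length≡sum-of-ones (x ∷ xs) = cong suc (length≡sum-of-ones xs)

  -- Indexing a list of naturals by ℕ, with default 0 past the end; the vector
  -- built from the edge list is read off through nth.
  nth : List ℕ → ℕ → ℕ
  nth []       k       = 0
  nth (x ∷ xs) zero    = x
  nth (x ∷ xs) (suc k) = nth xs k

  nth-All : ∀ {P : ℕ → Set} {xs} → All P xs → ∀ k → k < length xs → P (nth xs k)
  nth-All (p ∷ ps) zero    _         = p
  nth-All (p ∷ ps) (suc k) (s≤s k<n) = nth-All ps k k<n

  nth-++ˡ : ∀ xs ys k → k < length xs → nth (xs ++ ys) k ≡ nth xs k
  nth-++ˡ (x ∷ xs) ys zero    _         = refl
  nth-++ˡ (x ∷ xs) ys (suc k) (s≤s k<n) = nth-++ˡ xs ys k k<n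

  nth-++ʳ : ∀ xs ys k → length xs ≤ k → nth (xs ++ ys) k ≡ nth ys (k ∸ length xs)
  nth-++ʳ []       ys k       _         = refl
  nth-++ʳ (x ∷ xs) ys (suc k) (s≤s n≤k) = nth-++ʳ xs ys k n≤k

  Descending : List ℕ → Set
  Descending = AllPairs (λ x y → y ≤ x)

  nth-descending : ∀ {xs} → Descending xs → ∀ i j → i ≤ j → j < length xs → nth xs j ≤ nth xs i
  nth-descending (_ ∷ _)          zero    zero    _         _         = ≤-refl
  nth-descending (x≥xs ∷ _)       zero    (suc j) _         (s≤s j<n) = nth-All x≥xs j j<n
  nth-descending (_ ∷ xs↘)        (suc i) (suc j) (s≤s i≤j) (s≤s j<n) = nth-descending xs↘ i j i≤j j<n

  module DescendingSort = Data.List.Sort (Flip.decTotalOrder ≤-decTotalOrder)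

  sortDesc : List ℕ → List ℕ
  sortDesc = DescendingSort.sort

  sortDesc-descending : ∀ xs → Descending (sortDesc xs)
  sortDesc-descending xs = Sorted.Sorted⇒AllPairs (Flip.totalOrder ≤-totalOrder) (DescendingSort.sort-↗ xs)

  sortDesc-↭ : ∀ xs → sortDesc xs ↭ xs
  sortDesc-↭ = DescendingSort.sort-↭

  length-sortDesc : ∀ xs → length (sortDesc xs) ≡ length xs
  length-sortDesc xs = ↭-length (sortDesc-↭ xs)

  sum-sortDesc : ∀ xs → sum (sortDesc xs) ≡ sum xs
  sum-sortDesc xs = sum-↭ (sortDesc-↭ xs)

  sum-map-sortDesc : ∀ (φ : ℕ → ℕ) xs → sum (map φ (sortDesc xs)) ≡ sum (map φ xs)
  sum-map-sortDesc φ xs = sum-↭ (map⁺ φ (sortDesc-↭ xs))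

  All-sortDesc : ∀ {P : ℕ → Set} {xs} → All P xs → All P (sortDesc xs)
  All-sortDesc all = All-resp-↭ (↭-sym (sortDesc-↭ _)) all

  descending-++ : ∀ {c xs ys} → Descending xs → Descending ys →
                  All (c ≤_) xs → All (_≤ c) ys → Descending (xs ++ ys)
  descending-++ {c} xs↘ ys↘ xs≥c ys≤c =
    AllPairs.++⁺ xs↘ ys↘ (All.map (λ c≤x → All.map (λ y≤c → ≤-trans y≤c c≤x) ys≤c) xs≥c)

module GraphFacts {n : ℕ} (G : Graph n) where
  open import Data.Nat using (_+_; _*_; _≤_; _<_; _<ᵇ_; _<?_; s≤s)
  open import Data.Nat.Properties hiding (_≟_)
  open import Data.Fin using (Fin; toℕ; fromℕ<; _≟_)
  open import Data.Fin.Properties using (toℕ-injective; toℕ-fromℕ<; toℕ<n)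
  open import Data.Bool using (true; false; if_then_else_)
  open import Data.Sum using (_⊎_; inj₁; inj₂)
  open import Data.Empty using (⊥-elim)
  open import Relation.Nullary using (¬_; yes; no)
  open import Relation.Nullary.Reflects using (ofʸ; ofⁿ)
  open import Relation.Binary.PropositionalEquality
  open FiniteSums

  -- The contribution of the ordered pair (i, j) to a sum over edges: each
  -- edge {i, j} is counted once, from its smaller endpoint.
  edgeTerm : Fin n → Fin n → ℕ → ℕ
  edgeTerm i j v = if toℕ i <ᵇ toℕ j then b2n (adj G i j) * v else 0

  edgeSum : (Fin n → Fin n → ℕ) → ℕ
  edgeSum f = Σℕ n (λ i → Σℕ n (λ j → edgeTerm i j (f i j)))

  edgeSum-cong : ∀ {f g} → (∀ i j → f i j ≡ g i j) → edgeSum f ≡ edgeSum g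
  edgeSum-cong f≗g = Σ-cong n (λ i → Σ-cong n (λ j → cong (edgeTerm i j) (f≗g i j)))

  edgeTerm-+ : ∀ i j u v → edgeTerm i j (u + v) ≡ edgeTerm i j u + edgeTerm i j v
  edgeTerm-+ i j u v with toℕ i <ᵇ toℕ j
  ... | true  = *-distribˡ-+ (b2n (adj G i j)) u v
  ... | false = refl

  edgeSum-+ : ∀ f g → edgeSum (λ i j → f i j + g i j) ≡ edgeSum f + edgeSum g
  edgeSum-+ f g = trans (Σ-cong n (λ i → Σ-cong n (λ j → edgeTerm-+ i j (f i j) (g i j))))
                        (Σ²-+ n n _ _)

  edgeCount≡edgeSum : edgeCount G ≡ edgeSum (λ _ _ → 1)
  edgeCount≡edgeSum = Σ-cong n (λ i → Σ-cong n (λ j → one i j))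
    where
    one : ∀ i j → (if toℕ i <ᵇ toℕ j then b2n (adj G i j) else 0) ≡ edgeTerm i j 1
    one i j with toℕ i <ᵇ toℕ j
    ... | true  = sym (*-identityʳ _)
    ... | false = refl

  -- An edge counted from both ends is counted exactly once (the graph is
  -- symmetric and loopless).
  edgeTerm-both : ∀ i j v → edgeTerm i j v + edgeTerm j i v ≡ b2n (adj G i j) * v
  edgeTerm-both i j v rewrite Graph.sym G j i
    with toℕ i <ᵇ toℕ j | <ᵇ-reflects-< (toℕ i) (toℕ j) | toℕ j <ᵇ toℕ i | <ᵇ-reflects-< (toℕ j) (toℕ i)
  ... | true  | ofʸ i<j | true  | ofʸ j<i = ⊥-elim (<-asym i<j j<i)
  ... | true  | _       | false | _       = +-identityʳ _
  ... | false | _       | true  | _       = refl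
  ... | false | ofⁿ i≮j | false | ofⁿ j≮i with toℕ-injective (≤-antisym (≮⇒≥ j≮i) (≮⇒≥ i≮j))
  ...   | refl rewrite irref G i = refl

  handshake : ∀ (g : Fin n → ℕ) → edgeSum (λ i j → g i + g j) ≡ Σℕ n (λ i → deg G i * g i)
  handshake g = begin
      edgeSum (λ i j → g i + g j)
    ≡⟨ edgeSum-+ _ _ ⟩
      edgeSum (λ i _ → g i) + edgeSum (λ _ j → g j)
    ≡⟨ cong (edgeSum (λ i _ → g i) +_) (Σ-swap n n _) ⟩
      edgeSum (λ i _ → g i) + Σℕ n (λ i → Σℕ n (λ j → edgeTerm j i (g i)))
    ≡⟨ sym (Σ²-+ n n _ _) ⟩
      Σℕ n (λ i → Σℕ n (λ j → edgeTerm i j (g i) + edgeTerm j i (g i)))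
    ≡⟨ Σ-cong n (λ i → Σ-cong n (λ j → edgeTerm-both i j (g i))) ⟩
      Σℕ n (λ i → Σℕ n (λ j → b2n (adj G i j) * g i))
    ≡⟨ Σ-cong n (λ i → Σ-*ʳ n _ (g i)) ⟩
      Σℕ n (λ i → deg G i * g i)
    ∎
    where open ≡-Reasoning

  pendant-neighbour-unique : ∀ {i a b} → deg G i ≡ 1 → adj G i a ≡ true → adj G i b ≡ true → a ≡ b
  pendant-neighbour-unique {i} {a} {b} dᵢ≡1 ia ib with a ≟ b
  ... | yes a≡b = a≡b
  ... | no  a≢b = ⊥-elim (two≰one (subst₂ _≤_ (cong₂ (λ u v → b2n u + b2n v) ia ib) dᵢ≡1
                                           (Σ-two-terms n (λ j → b2n (adj G i j)) a b a≢b)))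
    where
    two≰one : ¬ 2 ≤ 1
    two≰one (s≤s ())

  -- In a connected graph an edge joining two vertices of degree 1 is the
  -- whole graph: walks from i never leave {i, j}.
  pendant-edge-spans : Connected G → ∀ {i j} → deg G i ≡ 1 → deg G j ≡ 1 → adj G i j ≡ true →
                       ∀ v → v ≡ i ⊎ v ≡ j
  pendant-edge-spans conn {i} {j} dᵢ≡1 dⱼ≡1 ij v = stays (conn i v)
    where
    ji : adj G j i ≡ true
    ji = trans (Graph.sym G j i) ij
    stays : ∀ {v} → Reach G i v → v ≡ i ⊎ v ≡ j
    stays here = inj₁ refl
    stays (step walk wv) with stays walk
    ... | inj₁ refl = inj₂ (pendant-neighbour-unique dᵢ≡1 wv ij)
    ... | inj₂ refl = inj₁ (pendant-neighbour-unique dⱼ≡1 wv ji)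

  degAt-fromℕ< : ∀ m (m<n : m < n) → degAt G m ≡ deg G (fromℕ< m<n)
  degAt-fromℕ< m m<n with m <? n
  ... | yes _   = refl
  ... | no  m≮n = ⊥-elim (m≮n m<n)

  module DegreeOrder (labelled↘ : DegNonincreasing G) where

    degAt≤deg : ∀ a m → toℕ a ≤ m → m < n → degAt G m ≤ deg G a
    degAt≤deg a m a≤m m<n = subst (_≤ deg G a) (sym (degAt-fromℕ< m m<n))
      (labelled↘ a (fromℕ< m<n) (subst (toℕ a ≤_) (sym (toℕ-fromℕ< m<n)) a≤m))

    deg≤degAt : ∀ a m → m ≤ toℕ a → deg G a ≤ degAt G m
    deg≤degAt a m m≤a = subst (deg G a ≤_) (sym (degAt-fromℕ< m m<n))
      (labelled↘ (fromℕ< m<n) a (subst (_≤ toℕ a) (sym (toℕ-fromℕ< m<n)) m≤a))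
      where
      m<n : m < n
      m<n = ≤-<-trans m≤a (toℕ<n a)

module EdgeDegreeSums {n : ℕ} (G : Graph n) (k : ℕ) where
  open import Data.Nat using (suc; _+_; _*_; _∸_; _≤_; _<_; _<ᵇ_; z≤n; s≤s)
  open import Data.Nat.Properties hiding (_≟_)
  open import Data.Nat.Solver using (module +-*-Solver)
  open import Data.Fin using (Fin; toℕ; fromℕ<)
  open import Data.Fin.Properties using (toℕ-fromℕ<; toℕ<n)
  open import Data.Bool using (Bool; true; false; if_then_else_; not; _∧_; T)
  open import Data.Bool.Properties using (∧-zeroʳ; ∧-identityʳ; T-∧; T-≡; T-not-≡)
  open import Data.List using (List; length; map)
  open import Data.List.Properties using (map-id)
  open import Data.Nat.ListAction using (sum)
  open import Data.List.Relation.Unary.All using (All)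
  open import Data.Product using (_×_; _,_)
  open import Data.Sum using (_⊎_; inj₁; inj₂)
  open import Data.Empty using (⊥; ⊥-elim)
  open import Function using (_∘_; id)
  open import Function.Bundles using (Equivalence)
  open import Relation.Nullary.Reflects using (ofⁿ)
  open import Relation.Binary.PropositionalEquality
  open FiniteSums
  open Lists
  open GraphFacts G

  d : Fin n → ℕ
  d = deg G

  isEdge : Fin n → Fin n → Bool
  isEdge i j = (toℕ i <ᵇ toℕ j) ∧ adj G i j

  edgeDegreeSums : (Fin n → Bool) → List ℕ
  edgeDegreeSums p = concatFin n (λ i → concatFin n (λ j → singletonIf (isEdge i j ∧ p j) (d i + d j)))

  sum-map-edgeDegreeSums : ∀ p (φ : ℕ → ℕ) → sum (map φ (edgeDegreeSums p))
    ≡ Σℕ n (λ i → Σℕ n (λ j → if isEdge i j ∧ p j then φ (d i + d j) else 0))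
  sum-map-edgeDegreeSums p φ =
    trans (cong sum (map-concatFin φ n _))
   (trans (sum-concatFin n _)
          (Σ-cong n (λ i → trans (cong sum (map-concatFin φ n _))
                          (trans (sum-concatFin n _)
                                 (Σ-cong n (λ j → entry i j))))))
    where
    entry : ∀ i j → sum (map φ (singletonIf (isEdge i j ∧ p j) (d i + d j)))
                    ≡ (if isEdge i j ∧ p j then φ (d i + d j) else 0)
    entry i j = trans (cong sum (map-singletonIf φ (isEdge i j ∧ p j) (d i + d j)))
                      (sum-singletonIf (isEdge i j ∧ p j) (φ (d i + d j)))

  split-edgeDegreeSums : ∀ p (φ : ℕ → ℕ) →
    sum (map φ (edgeDegreeSums p)) + sum (map φ (edgeDegreeSums (not ∘ p)))
      ≡ edgeSum (λ i j → φ (d i + d j))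
  split-edgeDegreeSums p φ =
    trans (cong₂ _+_ (sum-map-edgeDegreeSums p φ) (sum-map-edgeDegreeSums (not ∘ p) φ))
          (trans (sym (Σ²-+ n n _ _)) (Σ-cong n (λ i → Σ-cong n (λ j → split i j (φ (d i + d j))))))
    where
    split : ∀ i j v → (if isEdge i j ∧ p j then v else 0) + (if isEdge i j ∧ not (p j) then v else 0)
                      ≡ edgeTerm i j v
    split i j v with toℕ i <ᵇ toℕ j | adj G i j | p j
    ... | true  | true  | true  = refl
    ... | true  | true  | false = sym (+-identityʳ v)
    ... | true  | false | _     = refl
    ... | false | _     | _     = refl

  -- Index below k, i.e. not a pendant vertex of the theorem.
  below : Fin n → Bool
  below j = toℕ j <ᵇ k

  innerSums pendantSums : List ℕ
  innerSums   = edgeDegreeSums below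
  pendantSums = edgeDegreeSums (not ∘ below)

  -- Together the two lists have one entry per edge; their sum is the first
  -- Zagreb index Σ d_i², and their sum of squares is Σ d_i³ + 2·S(G),
  -- since (d_i + d_j)² = d_i² + d_j² + 2 d_i d_j.
  count-split : length innerSums + length pendantSums ≡ edgeCount G
  count-split = trans (cong₂ _+_ (length≡sum-of-ones innerSums) (length≡sum-of-ones pendantSums))
                      (trans (split-edgeDegreeSums below (λ _ → 1)) (sym edgeCount≡edgeSum))

  sum-split : sum innerSums + sum pendantSums ≡ Σℕ n (λ i → d i * d i)
  sum-split = trans (sym (cong₂ _+_ (cong sum (map-id innerSums)) (cong sum (map-id pendantSums))))
                    (trans (split-edgeDegreeSums below id) (handshake d))

  square-sum-split : sum (map (λ v → v * v) innerSums) + sum (map (λ v → v * v) pendantSums)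
                     ≡ Σℕ n (λ i → d i * d i * d i) + (zagreb2 G + zagreb2 G)
  square-sum-split = begin
      sum (map (λ v → v * v) innerSums) + sum (map (λ v → v * v) pendantSums)
    ≡⟨ split-edgeDegreeSums below (λ v → v * v) ⟩
      edgeSum (λ i j → (d i + d j) * (d i + d j))
    ≡⟨ edgeSum-cong (λ i j → square-of-sum (d i) (d j)) ⟩
      edgeSum (λ i j → (d i * d i + d j * d j) + (d i * d j + d i * d j))
    ≡⟨ edgeSum-+ _ _ ⟩
      edgeSum (λ i j → d i * d i + d j * d j) + edgeSum (λ i j → d i * d j + d i * d j)
    ≡⟨ cong₂ _+_ (handshake (λ i → d i * d i)) (edgeSum-+ _ _) ⟩
      Σℕ n (λ i → d i * (d i * d i)) + (zagreb2 G + zagreb2 G)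
    ≡⟨ cong (_+ (zagreb2 G + zagreb2 G)) (Σ-cong n (λ i → sym (*-assoc (d i) (d i) (d i)))) ⟩
      Σℕ n (λ i → d i * d i * d i) + (zagreb2 G + zagreb2 G)
    ∎
    where
    open ≡-Reasoning
    square-of-sum : ∀ a b → (a + b) * (a + b) ≡ (a * a + b * b) + (a * b + a * b)
    square-of-sum = solve 2 (λ a b → (a :+ b) :* (a :+ b) := (a :* a :+ b :* b) :+ (a :* b :+ a :* b)) refl
      where open +-*-Solver

  selected-edge : ∀ i j b → T (isEdge i j ∧ b) → toℕ i < toℕ j × adj G i j ≡ true × T b
  selected-edge i j b t with Equivalence.to T-∧ t
  ... | e , tb with Equivalence.to T-∧ e
  ...   | i<ᵇj , ij = <ᵇ⇒< (toℕ i) (toℕ j) i<ᵇj , Equivalence.to T-≡ ij , tb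

  tail-vertex : ∀ j → T (not (below j)) → k ≤ toℕ j
  tail-vertex j j≮ᵇk = ≮⇒≥ (λ j<k → subst T (Equivalence.to T-not-≡ j≮ᵇk) (<⇒<ᵇ j<k))

  m∸1<n : ∀ {a b} → 1 ≤ a → a ≤ b → a ∸ 1 < b
  m∸1<n {suc a} _ a<b = a<b

  module WithPendantTail (conn : Connected G) (labelled↘ : DegNonincreasing G)
                         (pendant : ∀ i → k ≤ toℕ i → d i ≡ 1) (1≤k : 1 ≤ k) (k≤n : k ≤ n) where
    open DegreeOrder labelled↘

    origin-not-in-tail : ∀ (0<n : 0 < n) → k ≤ toℕ (fromℕ< 0<n) → ⊥
    origin-not-in-tail 0<n k≤0 = <⇒≱ 1≤k (subst (k ≤_) (toℕ-fromℕ< 0<n) k≤0)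

    -- No two tail vertices are adjacent: such an edge would be the whole
    -- graph, yet vertex 0 lies outside the tail.
    tail-nonadjacent : ∀ i j → k ≤ toℕ i → k ≤ toℕ j → adj G i j ≡ true → ⊥
    tail-nonadjacent i j k≤i k≤j ij =
      excluded (pendant-edge-spans conn (pendant i k≤i) (pendant j k≤j) ij (fromℕ< 0<n))
      where
      0<n : 0 < n
      0<n = ≤-<-trans z≤n (toℕ<n i)
      excluded : fromℕ< 0<n ≡ i ⊎ fromℕ< 0<n ≡ j → ⊥
      excluded (inj₁ 0≡i) = origin-not-in-tail 0<n (subst (λ v → k ≤ toℕ v) (sym 0≡i) k≤i)
      excluded (inj₂ 0≡j) = origin-not-in-tail 0<n (subst (λ v → k ≤ toℕ v) (sym 0≡j) k≤j)

    -- Each tail vertex j has its single neighbour below it, so exactly one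
    -- edge {i < j} ends at j: there are n - k pendant edges.
    pendant-count : length pendantSums ≡ n ∸ k
    pendant-count = begin
        length pendantSums
      ≡⟨ length≡sum-of-ones pendantSums ⟩
        sum (map (λ _ → 1) pendantSums)
      ≡⟨ sum-map-edgeDegreeSums (not ∘ below) (λ _ → 1) ⟩
        Σℕ n (λ i → Σℕ n (λ j → if isEdge i j ∧ not (below j) then 1 else 0))
      ≡⟨ Σ-swap n n _ ⟩
        Σℕ n (λ j → Σℕ n (λ i → if isEdge i j ∧ not (below j) then 1 else 0))
      ≡⟨ Σ-cong n edges-ending-at ⟩
        Σℕ n (λ j → if toℕ j <ᵇ k then 0 else 1)
      ≡⟨ Σ-count-≥ n k ⟩
        n ∸ k
      ∎
      where
      open ≡-Reasoning
      from-below : ∀ j → k ≤ toℕ j → ∀ i → (if isEdge i j ∧ true then 1 else 0) ≡ b2n (adj G j i)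
      from-below j k≤j i rewrite Graph.sym G j i | ∧-identityʳ (isEdge i j)
        with toℕ i <ᵇ toℕ j | <ᵇ-reflects-< (toℕ i) (toℕ j) | adj G i j in ij
      ... | true  | _       | true  = refl
      ... | true  | _       | false = refl
      ... | false | ofⁿ i≮j | true  = ⊥-elim (tail-nonadjacent i j (≤-trans k≤j (≮⇒≥ i≮j)) k≤j ij)
      ... | false | _       | false = refl
      edges-ending-at : ∀ j → Σℕ n (λ i → if isEdge i j ∧ not (below j) then 1 else 0)
                              ≡ (if toℕ j <ᵇ k then 0 else 1)
      edges-ending-at j with toℕ j <ᵇ k | <ᵇ-reflects-< (toℕ j) k
      ... | true  | _       = trans (Σ-cong n (λ i → cong (λ b → if b then 1 else 0) (∧-zeroʳ (isEdge i j))))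
                                    (Σ-zero n)
      ... | false | ofⁿ j≮k = trans (Σ-cong n (from-below j (≮⇒≥ j≮k))) (pendant j (≮⇒≥ j≮k))

    -- An inner edge i < j < k has m₁ = d_{k-1} + d_{k-2} ≤ d_i + d_j ≤ d_0 + d_1 = M₁.
    inner-bounds : All (λ v → degAt G (k ∸ 1) + degAt G (k ∸ 2) ≤ v × v ≤ degAt G 0 + degAt G 1) innerSums
    inner-bounds = All-concatFin n _ (λ i → All-concatFin n _ (λ j → All-singletonIf _ _ (bounds i j)))
      where
      k∸1<n : k ∸ 1 < n
      k∸1<n = m∸1<n 1≤k k≤n
      k∸2<n : k ∸ 2 < n
      k∸2<n = ≤-<-trans (∸-monoʳ-≤ k (s≤s z≤n)) k∸1<n
      bounds : ∀ i j → T (isEdge i j ∧ below j) →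
               degAt G (k ∸ 1) + degAt G (k ∸ 2) ≤ d i + d j × d i + d j ≤ degAt G 0 + degAt G 1
      bounds i j sel with selected-edge i j (below j) sel
      ... | i<j , _ , j<ᵇk = lower , upper
        where
        j<k : toℕ j < k
        j<k = <ᵇ⇒< (toℕ j) k j<ᵇk
        lower : degAt G (k ∸ 1) + degAt G (k ∸ 2) ≤ d i + d j
        lower = subst (_≤ d i + d j) (+-comm (degAt G (k ∸ 2)) (degAt G (k ∸ 1)))
                  (+-mono-≤ (degAt≤deg i (k ∸ 2) (∸-monoˡ-≤ 2 (<-≤-trans (s≤s i<j) j<k)) k∸2<n)
                            (degAt≤deg j (k ∸ 1) (∸-monoˡ-≤ 1 j<k) k∸1<n))
        upper : d i + d j ≤ degAt G 0 + degAt G 1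
        upper = +-mono-≤ (deg≤degAt i 0 z≤n) (deg≤degAt j 1 (≤-trans (s≤s z≤n) i<j))

    -- A pendant edge i < j (j ≥ k, so i < k) has m₂ = 1 + d_{k-1} ≤ d_i + 1 ≤ 1 + d_0 = M₂.
    pendant-bounds : All (λ v → 1 + degAt G (k ∸ 1) ≤ v × v ≤ 1 + degAt G 0) pendantSums
    pendant-bounds = All-concatFin n _ (λ i → All-concatFin n _ (λ j → All-singletonIf _ _ (bounds i j)))
      where
      bounds : ∀ i j → T (isEdge i j ∧ not (below j)) →
               1 + degAt G (k ∸ 1) ≤ d i + d j × d i + d j ≤ 1 + degAt G 0
      bounds i j sel with selected-edge i j (not (below j)) sel
      ... | _ , ij , j≮ᵇk = lower , upper
        where
        k≤j : k ≤ toℕ j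
        k≤j = tail-vertex j j≮ᵇk
        i<k : toℕ i < k
        i<k = ≰⇒> (λ k≤i → tail-nonadjacent i j k≤i k≤j ij)
        lower : 1 + degAt G (k ∸ 1) ≤ d i + d j
        lower rewrite pendant j k≤j = subst (_≤ d i + 1) (+-comm (degAt G (k ∸ 1)) 1)
          (+-monoˡ-≤ 1 (degAt≤deg i (k ∸ 1) (∸-monoˡ-≤ 1 i<k) (m∸1<n 1≤k k≤n)))
        upper : d i + d j ≤ 1 + degAt G 0
        upper rewrite pendant j k≤j = subst (d i + 1 ≤_) (+-comm (degAt G 0) 1)
          (+-monoˡ-≤ 1 (deg≤degAt i 0 z≤n))

module BlockVector where
  open import Data.Nat using (zero; suc; _+_; _*_; _∸_; _≤_; _<_; z≤n)
  open import Data.Nat.Properties using (≤-trans; m+n∸n≡m; m+n∸m≡n; ∸-monoˡ-<; suc-injective)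
  open import Data.Fin using (toℕ; zero; suc)
  open import Data.Fin.Properties using (toℕ<n)
  import Data.Rational as ℚ
  open import Data.List using (List; []; _∷_; _++_; length; map)
  open import Data.List.Properties using (map-id; length-++)
  open import Data.Nat.ListAction using (sum)
  open import Data.Nat.ListAction.Properties using (sum-++)
  open import Data.List.Relation.Unary.All as All using (All)
  open import Data.Product using (_×_; _,_; proj₁; proj₂)
  open import Relation.Binary.PropositionalEquality
  open RationalFacts
  open Lists

  listVector : (m : ℕ) → List ℕ → Vecℚ m
  listVector m L i = toℚ (nth L (toℕ i))

  Σℚ-cong : ∀ m {f g : Vecℚ m} → (∀ i → f i ≡ g i) → Σℚ m f ≡ Σℚ m g
  Σℚ-cong zero    f≗g = refl
  Σℚ-cong (suc m) f≗g = cong₂ ℚ._+_ (f≗g zero) (Σℚ-cong m (λ i → f≗g (suc i)))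

  Σℚ-listVector : ∀ (φ : ℕ → ℕ) m L → length L ≡ m →
                  Σℚ m (λ i → toℚ (φ (nth L (toℕ i)))) ≡ toℚ (sum (map φ L))
  Σℚ-listVector φ zero    []      _   = refl
  Σℚ-listVector φ (suc m) (x ∷ L) len =
    trans (cong (toℚ (φ x) ℚ.+_) (Σℚ-listVector φ m L (suc-injective len))) (sym (toℚ-+ (φ x) _))

  normSq-listVector : ∀ m L → length L ≡ m → normSq (listVector m L) ≡ toℚ (sum (map (λ v → v * v) L))
  normSq-listVector m L len =
    trans (Σℚ-cong m (λ i → sym (toℚ-* (nth L (toℕ i)) (nth L (toℕ i)))))
          (Σℚ-listVector (λ v → v * v) m L len)

  blocks-∈S : ∀ {m h a lo₁ lo₂ hi₁ hi₂} (A B : List ℕ) → Descending A → Descending B →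
    All (λ v → lo₁ ≤ v × v ≤ hi₁) A → All (λ v → lo₂ ≤ v × v ≤ hi₂) B → hi₂ ≤ lo₁ →
    length A + length B ≡ m → length B ≡ h → sum A + sum B ≡ a →
    InS m h (toℚ a) (toℚ lo₁) (toℚ lo₂) (toℚ hi₁) (toℚ hi₂) (listVector m (A ++ B))
  blocks-∈S {m} {h} {a} {lo₁} {lo₂} {hi₁} {hi₂} A B A↘ B↘ A-bounds B-bounds hi₂≤lo₁ len len-B total =
    nonincreasing , (λ i → toℚ-mono {0} {entry (toℕ i)} z≤n) , sum-eq , first-block , second-block
    where
    length-A++B : length (A ++ B) ≡ m
    length-A++B = trans (length-++ A) len
    length-A : length A ≡ m ∸ h
    length-A = trans (sym (m+n∸n≡m (length A) h)) (cong (_∸ h) (trans (cong (length A +_) (sym len-B)) len))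
    nonincreasing : Nonincreasing (listVector m (A ++ B))
    nonincreasing i j i≤j = toℚ-mono (nth-descending AB↘ (toℕ i) (toℕ j) i≤j
                                         (subst (toℕ j <_) (sym length-A++B) (toℕ<n j)))
      where
      AB↘ : Descending (A ++ B)
      AB↘ = descending-++ {lo₁} A↘ B↘ (All.map proj₁ A-bounds)
                                      (All.map (λ b → ≤-trans (proj₂ b) hi₂≤lo₁) B-bounds)
    sum-eq : Σℚ m (listVector m (A ++ B)) ≡ toℚ a
    sum-eq = trans (Σℚ-listVector (λ v → v) m (A ++ B) length-A++B)
                   (cong toℚ (trans (cong sum (map-id (A ++ B))) (trans (sum-++ A B) total)))
    entry : ℕ → ℕ
    entry k = nth (A ++ B) k
    first-block : ∀ i → toℕ i < m ∸ h →
                  (toℚ (entry (toℕ i)) ℚ.≤ toℚ hi₁) × (toℚ lo₁ ℚ.≤ toℚ (entry (toℕ i)))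
    first-block i i<m∸h = toℚ-mono (proj₂ in-A) , toℚ-mono (proj₁ in-A)
      where
      i<|A| : toℕ i < length A
      i<|A| = subst (toℕ i <_) (sym length-A) i<m∸h
      in-A : lo₁ ≤ entry (toℕ i) × entry (toℕ i) ≤ hi₁
      in-A = subst (λ v → lo₁ ≤ v × v ≤ hi₁) (sym (nth-++ˡ A B (toℕ i) i<|A|)) (nth-All A-bounds (toℕ i) i<|A|)
    second-block : ∀ i → m ∸ h ≤ toℕ i →
                   (toℚ (entry (toℕ i)) ℚ.≤ toℚ hi₂) × (toℚ lo₂ ℚ.≤ toℚ (entry (toℕ i)))
    second-block i m∸h≤i = toℚ-mono (proj₂ in-B) , toℚ-mono (proj₁ in-B)
      where
      |A|≤i : length A ≤ toℕ i
      |A|≤i = subst (_≤ toℕ i) (sym length-A) m∸h≤i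
      i<|A|+|B| : toℕ i < length A + length B
      i<|A|+|B| = subst (toℕ i <_) (sym len) (toℕ<n i)
      i∸|A|<|B| : toℕ i ∸ length A < length B
      i∸|A|<|B| = subst (toℕ i ∸ length A <_) (m+n∸m≡n (length A) (length B)) (∸-monoˡ-< i<|A|+|B| |A|≤i)
      in-B : lo₂ ≤ entry (toℕ i) × entry (toℕ i) ≤ hi₂
      in-B = subst (λ v → lo₂ ≤ v × v ≤ hi₂) (sym (nth-++ʳ A B (toℕ i) |A|≤i))
                   (nth-All B-bounds (toℕ i ∸ length A) i∸|A|<|B|)

open import Data.Nat using (_≤_; _<_; _∸_; _+_; _*_)
open import Data.Fin using (Fin; toℕ)
open import Data.Rational using (½) renaming (_≤_ to _≤ℚ_; _-_ to _-ℚ_; _*_ to _*ℚ_)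
open import Relation.Binary.PropositionalEquality using (_≡_; _≢_)
open import Data.Product using (_×_)

module EdgeVector {n : ℕ} (G : Graph n) (h : ℕ) (conn : Connected G) (labelled↘ : DegNonincreasing G)
                  (pendant : ∀ (i : Fin n) → n ∸ h ≤ toℕ i → deg G i ≡ 1) (1≤k : 1 ≤ n ∸ h)
                  (separated : 1 + degAt G 0 ≤ degAt G (n ∸ h ∸ 1) + degAt G (n ∸ h ∸ 2)) where
  open import Data.Nat.Properties using (<⇒≤; >⇒≢; m∸n≢0⇒n<m; m∸[m∸n]≡n; m∸n≤m)
  import Data.Rational as ℚ
  open import Data.List using (List; _++_; map; length)
  open import Data.List.Properties using (map-++; length-++)
  open import Data.Nat.ListAction using (sum)
  open import Data.Nat.ListAction.Properties using (sum-++)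
  open import Relation.Binary.PropositionalEquality using (cong; cong₂; trans; module ≡-Reasoning)
  open RationalFacts
  open Lists
  open BlockVector

  k : ℕ
  k = n ∸ h
  open EdgeDegreeSums G k
  open WithPendantTail conn labelled↘ pendant 1≤k (m∸n≤m n h)

  h≤n : h ≤ n
  h≤n = <⇒≤ (m∸n≢0⇒n<m {n} {h} (>⇒≢ 1≤k))

  A B : List ℕ
  A = sortDesc innerSums
  B = sortDesc pendantSums

  |A|+|B| : length A + length B ≡ edgeCount G
  |A|+|B| = trans (cong₂ _+_ (length-sortDesc innerSums) (length-sortDesc pendantSums)) count-split

  y : Vecℚ (edgeCount G)
  y = listVector (edgeCount G) (A ++ B)

  y∈S : InS (edgeCount G) h (toℚ (Σℕ n (λ i → deg G i * deg G i)))
          (toℚ (degAt G (k ∸ 1) + degAt G (k ∸ 2))) (toℚ (1 + degAt G (k ∸ 1)))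
          (toℚ (degAt G 0 + degAt G 1)) (toℚ (1 + degAt G 0)) y
  y∈S = blocks-∈S A B (sortDesc-descending innerSums) (sortDesc-descending pendantSums)
          (All-sortDesc inner-bounds) (All-sortDesc pendant-bounds) separated |A|+|B|
          (trans (length-sortDesc pendantSums) (trans pendant-count (m∸[m∸n]≡n h≤n)))
          (trans (cong₂ _+_ (sum-sortDesc innerSums) (sum-sortDesc pendantSums)) sum-split)

  normSq-y : normSq y ≡ toℚ (Σℕ n (λ i → deg G i * deg G i * deg G i))
                         ℚ.+ (toℚ (zagreb2 G) ℚ.+ toℚ (zagreb2 G))
  normSq-y = begin
      normSq y
    ≡⟨ normSq-listVector (edgeCount G) (A ++ B) (trans (length-++ A) |A|+|B|) ⟩
      toℚ (sum (map square (A ++ B)))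
    ≡⟨ cong toℚ (trans (cong sum (map-++ square A B)) (sum-++ (map square A) (map square B))) ⟩
      toℚ (sum (map square A) + sum (map square B))
    ≡⟨ cong toℚ (trans (cong₂ _+_ (sum-map-sortDesc square innerSums) (sum-map-sortDesc square pendantSums))
                        square-sum-split) ⟩
      toℚ (D + (Z + Z))
    ≡⟨ trans (toℚ-+ D (Z + Z)) (cong (toℚ D ℚ.+_) (toℚ-+ Z Z)) ⟩
      toℚ D ℚ.+ (toℚ Z ℚ.+ toℚ Z)
    ∎
    where
    open ≡-Reasoning
    D = Σℕ n (λ i → deg G i * deg G i * deg G i)
    Z = zagreb2 G
    square : ℕ → ℕ
    square v = v * v

open import Data.Nat using (z≤n; s≤s)
open import Data.Nat.Properties using (≤-trans)
open import Data.Product using (_,_; proj₁)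
open import Relation.Binary.PropositionalEquality using (subst)
open RationalFacts using (halve-≤; ≤-halve)
open Majorization using (normSq-mono-⊴)

-- The edge vector y lies in S, so x_*(S) ⊴ y ⊴ x^*(S); Schur-convexity of the
-- squared norm gives ‖x_*‖² ≤ ‖y‖² = Σ d³ + 2 S(G) ≤ ‖x^*‖², and halving
-- the excess over Σ d³ yields both bounds.
mainTheorem6 : (n h : ℕ) (G : Graph n) → Connected G → 4 ≤ n
    → DegNonincreasing G → 1 ≤ h → 2 ≤ n ∸ h
    → (∀ (i : Fin n) → n ∸ h ≤ toℕ i → deg G i ≡ 1)
    → (∀ (i : Fin n) → toℕ i < n ∸ h → deg G i ≢ 1)
    → 1 + degAt G 0 ≤ degAt G (n ∸ h ∸ 1) + degAt G (n ∸ h ∸ 2)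
    → (xU xL : Vecℚ (edgeCount G))
    → IsMaximal (InS (edgeCount G) h
                   (toℚ (Σℕ n (λ i → deg G i * deg G i)))
                   (toℚ (degAt G (n ∸ h ∸ 1) + degAt G (n ∸ h ∸ 2)))
                   (toℚ (1 + degAt G (n ∸ h ∸ 1)))
                   (toℚ (degAt G 0 + degAt G 1))
                   (toℚ (1 + degAt G 0))) xU
    → IsMinimal (InS (edgeCount G) h
                   (toℚ (Σℕ n (λ i → deg G i * deg G i)))
                   (toℚ (degAt G (n ∸ h ∸ 1) + degAt G (n ∸ h ∸ 2)))
                   (toℚ (1 + degAt G (n ∸ h ∸ 1)))
                   (toℚ (degAt G 0 + degAt G 1))
                   (toℚ (1 + degAt G 0))) xL
    → ((normSq xL -ℚ toℚ (Σℕ n (λ i → deg G i * deg G i * deg G i))) *ℚ ½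
         ≤ℚ toℚ (zagreb2 G))
      × (toℚ (zagreb2 G)
         ≤ℚ (normSq xU -ℚ toℚ (Σℕ n (λ i → deg G i * deg G i * deg G i))) *ℚ ½)
mainTheorem6 n h G conn _ labelled↘ _ 2≤k pendant _ separated xU xL (_ , xU-max) ((xL↘ , _) , xL-min) =
  halve-≤ (subst (normSq xL ≤ℚ_) normSq-y (normSq-mono-⊴ xL y xL↘ (xL-min y y∈S))) ,
  ≤-halve (subst (_≤ℚ normSq xU) normSq-y (normSq-mono-⊴ y xU (proj₁ y∈S) (xU-max y y∈S)))
  where open EdgeVector G h conn labelled↘ pendant (≤-trans (s≤s z≤n) 2≤k) separated
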